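{- Let $d\ge1$, $k\ge0$, $n=d+k+1$, and let $\gamma=(\gamma_1,\dots,\gamma_l)$, $l\ge1$, be the type of some element of $L_{n,d}$. Then \[ \lambda_{n,d}(\gamma)=\frac{1}{\prod_{s\ge1}m_s(\gamma)!}\sum_{j=0}^{n}c(j,d;\gamma)\binom{n}{j}, \] where $m_s(\gamma)=|\{i:\gamma_i=s\}|$, and the numbers $c(j,d;\gamma)$ (defined below) do not depend on $n$.
   Context: For integers $n\ge 1$ (more generally $n\ge0$), $d\ge 0$: for a finite set $X$ put $\operatorname{codim}_d(X)=d+1-|X|$. For a family $T=\{T_1,\dots,T_l\}$ of distinct finite sets put $\rho_d(T)=\sum_i\operatorname{codim}_d(T_i)$ and $D_d(T)=\operatorname{codim}_d(T_1\cap\dots\cap T_l)-\rho_d(T)$. Let $L_{n,d}$ be the set of families $T\subset 2^{\{1,\dots,n\}}$ such that $0\le|T_i|\le d$ for all $T_i\in T$ and $D_d(T')>0$ for every subfamily $T'\subset T$ with $|T'|>1$. The type of $T=\{T_1,\dots,T_l\}\in L_{n,d}$, listed so that $|T_1|\le\dots\le|T_l|$, is the partition $(\operatorname{codim}_d(T_1),\dots,\operatorname{codim}_d(T_l))$. $\lambda_{n,d}(\gamma)$ is the number of elements of $L_{n,d}$ of type $\gamma$. For an integer $j\ge0$, $c(j,d;\gamma)$ is the number of ordered tuples $(T_1,\dots,T_l)$ of pairwise distinct subsets of $\{1,\dots,j\}$ such that $\{T_1,\dots,T_l\}\in L_{j,d}$ (same definition with $n$ replaced by $j$), $\operatorname{codim}_d(T_i)=\gamma_i$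 for each $i$, and $T_1\cup\dots\cup T_l=\{1,\dots,j\}$. -}

module Defs where

open import Data.Bool using (Bool)
import Data.Bool as Bool
open import Data.Nat using (ℕ; zero; suc; _+_; _*_; _∸_; _≤_; _<_; _≤?_; _<?_)
import Data.Nat.Properties as ℕP
open import Data.Nat using (_!)
open import Data.Nat.ListAction using (sum; product)
open import Data.Nat.Combinatorics using (_C_)
open import Data.Integer as ℤ using (ℤ; +_)
import Data.Integer.Properties as ℤP
open import Data.Fin.Subset using (Subset; ∣_∣; _∩_; _∪_; ⊤; ⊥; inside; outside)
open import Data.Vec using (Vec; []; _∷_)
import Data.Vec.Properties as VecP
open import Data.List using (List; []; _∷_; _++_; map; length; filter; foldr; upTo; reverse)
import Data.List.Properties as ListP
open import Data.List.Relation.Unary.All using (All; all?)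
open import Data.List.Relation.Unary.Unique.Propositional using (Unique)
open import Data.Product using (_×_; _,_)
open import Relation.Nullary.Decidable using (Dec; _×-dec_; _→-dec_)
import Relation.Nullary.Decidable as Dec
open import Relation.Binary.PropositionalEquality using (_≡_)
open import Relation.Binary.Definitions using (DecidableEquality)

_≟S_ : {n : ℕ} → DecidableEquality (Subset n)
_≟S_ = VecP.≡-dec Bool._≟_

import Data.List.Relation.Unary.Unique.DecPropositional as UDec

subsets : (n : ℕ) → List (Subset n)
subsets zero    = [] ∷ []
subsets (suc n) = map (outside ∷_) (subsets n) ++ map (inside ∷_) (subsets n)

sublists : {A : Set} → List A → List (List A)
sublists []       = [] ∷ []
sublists (x ∷ xs) = sublists xs ++ map (x ∷_) (sublists xs)

-- all families T ⊂ 2^{1..n}, each exactly once (as duplicate-free lists)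
families : (n : ℕ) → List (List (Subset n))
families n = sublists (subsets n)

codim : {n : ℕ} → ℕ → Subset n → ℤ
codim d X = + (d + 1) ℤ.- + ∣ X ∣

⋂ : {n : ℕ} → List (Subset n) → Subset n
⋂ = foldr _∩_ ⊤

⋃ : {n : ℕ} → List (Subset n) → Subset n
⋃ = foldr _∪_ ⊥

ρ : {n : ℕ} → ℕ → List (Subset n) → ℤ
ρ d T = foldr ℤ._+_ (+ 0) (map (codim d) T)

D : {n : ℕ} → ℕ → List (Subset n) → ℤ
D d T = codim d (⋂ T) ℤ.- ρ d T

-- T ∈ L_{n,d} (T a family of distinct subsets, given as a duplicate-free list)
InL : {n : ℕ} → ℕ → List (Subset n) → Set
InL d T = Unique T
        × All (λ X → ∣ X ∣ ≤ d) T
        × All (λ T' → 1 < length T' → + 0 ℤ.< D d T') (sublists T)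

InL? : {n : ℕ} (d : ℕ) (T : List (Subset n)) → Dec (InL d T)
InL? {n} d T = UDec.unique? (_≟S_ {n}) T
         ×-dec all? (λ X → ∣ X ∣ ≤? d) T
         ×-dec all? (λ T' → (1 <? length T') →-dec (+ 0 ℤP.<? D d T')) (sublists T)

-- codim as a natural number (agrees with codim for |X| ≤ d, which holds in L)
codimℕ : {n : ℕ} → ℕ → Subset n → ℕ
codimℕ d X = d + 1 ∸ ∣ X ∣

insertDesc : ℕ → List ℕ → List ℕ
insertDesc x []       = x ∷ []
insertDesc x (y ∷ ys) with y ≤? x
... | Dec.yes _ = x ∷ y ∷ ys
... | Dec.no  _ = y ∷ insertDesc x ys

sortDesc : List ℕ → List ℕ
sortDesc = foldr insertDesc []

-- type of T: codims listed with |T_1| ≤ … ≤ |T_l|, i.e. codims nonincreasing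
type : {n : ℕ} → ℕ → List (Subset n) → List ℕ
type d T = sortDesc (map (codimℕ d) T)

count : {A : Set} {P : A → Set} → ((x : A) → Dec (P x)) → List A → ℕ
count P? xs = length (filter P? xs)

λnd : (n d : ℕ) → List ℕ → ℕ
λnd n d γ = count (λ T → InL? d T ×-dec (ListP.≡-dec Data.Nat._≟_ (type d T) γ)) (families n)

tuples : (j : ℕ) → List ℕ → List (List (Subset j))
tuples j []      = [] ∷ []
tuples j (_ ∷ γ) = Data.List.concatMap (λ X → map (X ∷_) (tuples j γ)) (subsets j)

c : (j d : ℕ) → List ℕ → ℕ
c j d γ = count (λ T → InL? d T
                  ×-dec ListP.≡-dec Data.Nat._≟_ (map (codimℕ d) T) γ
                  ×-dec (⋃ T ≟S ⊤))
                (tuples j γ)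

mult : List ℕ → ℕ → ℕ
mult γ s = count (λ g → g Data.Nat.≟ s) γ

-- ∏_{s ≥ 1} m_s(γ)!  (factors with s > sum γ have m_s = 0, hence are 1)
multProd : List ℕ → ℕ
multProd γ = product (map (λ s → (mult γ (suc s)) !) (upTo (sum γ)))

Σ≤ : ℕ → (ℕ → ℕ) → ℕ
Σ≤ n f = sum (map f (upTo (suc n)))

-- Both sides count the ordered tuples (T₁,…,T_l) of distinct subsets of {1,…,n} that form an
-- element of L_{n,d} with codim_d(Tᵢ) = γᵢ. An unordered family of type γ has exactly ∏ m_s(γ)!
-- such orderings, which gives the left-hand side. Grouping the tuples by their union gives the
-- right-hand side: membership in L and the codimensions only see the points lying in some Tᵢ,
-- so a tuple is a j-element union together with a spanning tuple on {1,…,j}. Formally this is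
-- an induction on n that splits off the first point: its column in the tuple is either empty,
-- and the point can be deleted, or it is not, and the point is part of the union; the two cases
-- combine by Pascal's rule.

module Submission where

open import Defs
open import Data.Bool using (Bool; true; false; if_then_else_; _∧_; _∨_)
import Data.Integer as ℤ
import Data.Integer.Properties as ℤP
open import Data.Fin using (Fin; zero; suc)
open import Data.Fin.Subset using (Subset; ⊤; _∩_; _∪_; ∣_∣; inside; outside)
import Data.Fin.Subset.Properties as SubsetP
open import Data.Nat using (ℕ; zero; suc; _∸_; _+_; _*_; _≤_; _<_; _≤?_; _≟_; _!; s≤s)
import Data.Nat.Properties as ℕP
open import Data.Nat.Properties
  using (≤-decTotalOrder; +-assoc; +-identityʳ; *-identityʳ; *-zeroʳ; *-distribˡ-+; *-comm; *-assoc)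
open import Algebra.Properties.CommutativeSemigroup ℕP.+-commutativeSemigroup using (interchange)
open import Data.Nat.ListAction using (sum; product)
open import Data.Nat.ListAction.Properties using (sum-↭)
open import Data.Nat.Combinatorics using (_C_; nCk+nC[k+1]≡[n+1]C[k+1]; k>n⇒nCk≡0)
open import Data.Vec using (Vec; []; _∷_; insertAt; removeAt)
import Data.Vec.Properties as VecP
open import Data.List using (List; []; _∷_; _++_; map; concatMap; concat; filter; length; applyUpTo)
import Data.List.Properties as ListP
open import Data.List.Membership.Propositional using (_∈_; _∉_; find)
import Data.List.Membership.Propositional.Properties as ListMemP
open import Data.List.Membership.Propositional.Properties using (∈-concatMap⁻; ∈-map⁻; ∈-filter⁺; ∈-filter⁻)
open import Data.List.Membership.Propositional.Properties.WithK using (unique∧set⇒bag)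
open import Data.List.Relation.Binary.BagAndSetEquality using (∼bag⇒↭)
open import Data.List.Relation.Binary.Subset.Propositional using (_⊆_)
open import Data.List.Relation.Binary.Permutation.Propositional
  using (_↭_; ↭⇒↭ₛ; ↭-refl; ↭-prep; ↭-swap; ↭-trans; ↭-sym)
import Data.List.Relation.Binary.Permutation.Propositional as ↭
import Data.List.Relation.Binary.Permutation.Propositional.Properties as ↭P
import Data.List.Relation.Binary.Permutation.Setoid.Properties as ↭ₛP
open import Data.List.Relation.Binary.Pointwise using (Pointwise-≡⇒≡)
open import Data.List.Relation.Unary.All using (All; []; _∷_)
import Data.List.Relation.Unary.All as All
import Data.List.Relation.Unary.All.Properties as AllP
open import Data.List.Relation.Unary.AllPairs using ([]; _∷_)
open import Data.List.Relation.Unary.Any using (here; there)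
import Data.List.Relation.Unary.Any as Any
open import Data.List.Relation.Unary.Sorted.TotalOrder.Properties using (↗↭↗⇒≋)
open import Data.List.Relation.Unary.Unique.Propositional using (Unique)
import Data.List.Relation.Unary.Unique.Propositional.Properties as UniqueP
import Data.List.Relation.Unary.Unique.DecPropositional as UniqueDec
open import Data.Product using (Σ; _×_; _,_; proj₁; proj₂)
open import Data.Sum using (inj₁; inj₂)
open import Function using (_∘_; _⇔_; mk⇔; Equivalence; case_of_)
open import Relation.Binary.Bundles using (DecTotalOrder)
open import Relation.Binary.Definitions using (Decidable; DecidableEquality)
import Relation.Binary.Construct.Flip.EqAndOrd as Flip
open import Relation.Nullary using (Dec; yes; no; ¬_; ¬?; contradiction)
open import Relation.Nullary.Decidable using (_×-dec_; dec-true; dec-false; map′)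
open import Relation.Binary.PropositionalEquality
open ≡-Reasoning

-- Indicator sums

private variable
  P Q : Set

𝟙 : Dec P → ℕ
𝟙 (yes _) = 1
𝟙 (no _)  = 0

𝟙-yes : (p? : Dec P) → P → 𝟙 p? ≡ 1
𝟙-yes (yes _) _ = refl
𝟙-yes (no ¬p) p = contradiction p ¬p

𝟙-no : (p? : Dec P) → ¬ P → 𝟙 p? ≡ 0
𝟙-no (yes p) ¬p = contradiction p ¬p
𝟙-no (no _)  _  = refl

𝟙-× : (p? : Dec P) (q? : Dec Q) → 𝟙 (p? ×-dec q?) ≡ 𝟙 p? * 𝟙 q?
𝟙-× (yes _) (yes _) = refl
𝟙-× (yes _) (no _)  = refl
𝟙-× (no _)  _       = refl

𝟙-cong : (p? : Dec P) (q? : Dec Q) → P ⇔ Q → 𝟙 p? ≡ 𝟙 q?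
𝟙-cong (yes p) q? P⇔Q = sym (𝟙-yes q? (Equivalence.to P⇔Q p))
𝟙-cong (no ¬p) q? P⇔Q = sym (𝟙-no q? (¬p ∘ Equivalence.from P⇔Q))

module _ {A : Set} where

  ∑ : (A → ℕ) → List A → ℕ
  ∑ f xs = sum (map f xs)

  ∑-++ : (f : A → ℕ) (xs ys : List A) → ∑ f (xs ++ ys) ≡ ∑ f xs + ∑ f ys
  ∑-++ f []       ys = refl
  ∑-++ f (x ∷ xs) ys = trans (cong (f x +_) (∑-++ f xs ys)) (sym (+-assoc (f x) _ _))

  ∑-cong : {f g : A → ℕ} (xs : List A) → (∀ x → x ∈ xs → f x ≡ g x) → ∑ f xs ≡ ∑ g xs
  ∑-cong []       f≗g = refl
  ∑-cong (x ∷ xs) f≗g = cong₂ _+_ (f≗g x (here refl)) (∑-cong xs (λ y y∈ → f≗g y (there y∈)))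

  ∑-vanishes : {f : A → ℕ} (xs : List A) → (∀ x → x ∈ xs → f x ≡ 0) → ∑ f xs ≡ 0
  ∑-vanishes []       f≗0 = refl
  ∑-vanishes (x ∷ xs) f≗0 = cong₂ _+_ (f≗0 x (here refl)) (∑-vanishes xs (λ y y∈ → f≗0 y (there y∈)))

  ∑-+ : (f g : A → ℕ) (xs : List A) → ∑ (λ x → f x + g x) xs ≡ ∑ f xs + ∑ g xs
  ∑-+ f g []       = refl
  ∑-+ f g (x ∷ xs) = trans (cong (f x + g x +_) (∑-+ f g xs)) (interchange (f x) (g x) _ _)

  ∑-*ˡ : (k : ℕ) (f : A → ℕ) (xs : List A) → ∑ (λ x → k * f x) xs ≡ k * ∑ f xs
  ∑-*ˡ k f []       = sym (*-zeroʳ k)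
  ∑-*ˡ k f (x ∷ xs) = trans (cong (k * f x +_) (∑-*ˡ k f xs)) (sym (*-distribˡ-+ k (f x) _))

  ∑-*ʳ : (k : ℕ) (f : A → ℕ) (xs : List A) → ∑ (λ x → f x * k) xs ≡ ∑ f xs * k
  ∑-*ʳ k f xs = begin
    ∑ (λ x → f x * k) xs ≡⟨ ∑-cong xs (λ x _ → *-comm (f x) k) ⟩
    ∑ (λ x → k * f x) xs ≡⟨ ∑-*ˡ k f xs ⟩
    k * ∑ f xs           ≡⟨ *-comm k _ ⟩
    ∑ f xs * k           ∎

  length-filter≡∑𝟙 : {P : A → Set} (P? : ∀ x → Dec (P x)) (xs : List A) →
                     length (filter P? xs) ≡ ∑ (𝟙 ∘ P?) xs
  length-filter≡∑𝟙 P? []       = refl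
  length-filter≡∑𝟙 P? (x ∷ xs) with P? x
  ... | yes _ = cong suc (length-filter≡∑𝟙 P? xs)
  ... | no _  = length-filter≡∑𝟙 P? xs

  ∑-↭ : (f : A → ℕ) {xs ys : List A} → xs ↭ ys → ∑ f xs ≡ ∑ f ys
  ∑-↭ f xs↭ys = sum-↭ (↭P.map⁺ f xs↭ys)

  ∑-filter : {P : A → Set} (P? : ∀ x → Dec (P x)) (h : A → ℕ) (xs : List A) →
             ∑ (λ x → 𝟙 (P? x) * h x) xs ≡ ∑ h (filter P? xs)
  ∑-filter P? h []       = refl
  ∑-filter P? h (x ∷ xs) with P? x
  ... | yes _ = cong₂ _+_ (+-identityʳ (h x)) (∑-filter P? h xs)
  ... | no _  = ∑-filter P? h xs

module _ {A B : Set} where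

  ∑-map : (f : B → ℕ) (g : A → B) (xs : List A) → ∑ f (map g xs) ≡ ∑ (f ∘ g) xs
  ∑-map f g []       = refl
  ∑-map f g (x ∷ xs) = cong (f (g x) +_) (∑-map f g xs)

  ∑-concatMap : (f : B → ℕ) (h : A → List B) (xs : List A) →
                ∑ f (concatMap h xs) ≡ ∑ (∑ f ∘ h) xs
  ∑-concatMap f h []       = refl
  ∑-concatMap f h (x ∷ xs) =
    trans (∑-++ f (h x) (concat (map h xs))) (cong (∑ f (h x) +_) (∑-concatMap f h xs))

  ∑-comm : (h : A → B → ℕ) (xs : List A) (ys : List B) →
           ∑ (λ x → ∑ (h x) ys) xs ≡ ∑ (λ y → ∑ (λ x → h x y) xs) ys
  ∑-comm h []       ys = sym (∑-vanishes ys (λ _ _ → refl))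
  ∑-comm h (x ∷ xs) ys = trans (cong (∑ (h x) ys +_) (∑-comm h xs ys)) (sym (∑-+ (h x) _ ys))

∑< : ℕ → (ℕ → ℕ) → ℕ
∑< zero    f = 0
∑< (suc N) f = f 0 + ∑< N (f ∘ suc)

∑-applyUpTo : (f g : ℕ → ℕ) (N : ℕ) → ∑ f (applyUpTo g N) ≡ ∑< N (f ∘ g)
∑-applyUpTo f g zero    = refl
∑-applyUpTo f g (suc N) = cong (f (g 0) +_) (∑-applyUpTo f (g ∘ suc) N)

Σ≤≡∑< : (n : ℕ) (f : ℕ → ℕ) → Σ≤ n f ≡ ∑< (suc n) f
Σ≤≡∑< n f = ∑-applyUpTo f (λ j → j) (suc n)

∑<-cong : (N : ℕ) {f g : ℕ → ℕ} → (∀ j → f j ≡ g j) → ∑< N f ≡ ∑< N g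
∑<-cong zero    f≗g = refl
∑<-cong (suc N) f≗g = cong₂ _+_ (f≗g 0) (∑<-cong N (f≗g ∘ suc))

∑<-+ : (N : ℕ) (f g : ℕ → ℕ) → ∑< N (λ j → f j + g j) ≡ ∑< N f + ∑< N g
∑<-+ zero    f g = refl
∑<-+ (suc N) f g = trans (cong (f 0 + g 0 +_) (∑<-+ N (f ∘ suc) (g ∘ suc))) (interchange (f 0) (g 0) _ _)

∑<-suc : (N : ℕ) (f : ℕ → ℕ) → ∑< (suc N) f ≡ ∑< N f + f N
∑<-suc zero    f = +-identityʳ (f 0)
∑<-suc (suc N) f = trans (cong (f 0 +_) (∑<-suc N (f ∘ suc))) (sym (+-assoc (f 0) _ _))

∑-∑< : {A : Set} (N : ℕ) (h : A → ℕ → ℕ) (xs : List A) →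
       ∑ (λ x → ∑< N (h x)) xs ≡ ∑< N (λ j → ∑ (λ x → h x j) xs)
∑-∑< zero    h xs = ∑-vanishes xs (λ _ _ → refl)
∑-∑< (suc N) h xs =
  trans (∑-+ (λ x → h x 0) _ xs) (cong (∑ (λ x → h x 0) xs +_) (∑-∑< N (λ x → h x ∘ suc) xs))

∑<-binomial-suc : (m : ℕ) (a : ℕ → ℕ) →
  ∑< (suc (suc m)) (λ j → (suc m C j) * a j)
  ≡ ∑< (suc m) (λ j → (m C j) * a j) + ∑< (suc m) (λ j → (m C j) * a (suc j))
∑<-binomial-suc m a = begin
  1 * a 0 + ∑< (suc m) (λ j → (suc m C suc j) * a (suc j))
    ≡⟨ cong (1 * a 0 +_) (∑<-cong (suc m) pascal) ⟩
  1 * a 0 + ∑< (suc m) (λ j → (m C j) * a (suc j) + (m C suc j) * a (suc j))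
    ≡⟨ cong (1 * a 0 +_) (∑<-+ (suc m) (λ j → (m C j) * a (suc j)) (λ j → (m C suc j) * a (suc j))) ⟩
  1 * a 0 + (B + ∑< (suc m) (λ j → (m C suc j) * a (suc j)))
    ≡⟨ cong (λ z → 1 * a 0 + (B + z)) (∑<-suc m (λ j → (m C suc j) * a (suc j))) ⟩
  1 * a 0 + (B + (∑< m (λ j → (m C suc j) * a (suc j)) + (m C suc m) * a (suc m)))
    ≡⟨ cong (λ z → 1 * a 0 + (B + (∑< m (λ j → (m C suc j) * a (suc j)) + z * a (suc m))))
            (k>n⇒nCk≡0 (ℕP.n<1+n m)) ⟩
  1 * a 0 + (B + (∑< m (λ j → (m C suc j) * a (suc j)) + 0))
    ≡⟨ cong (λ z → 1 * a 0 + (B + z)) (+-identityʳ _) ⟩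
  1 * a 0 + (B + ∑< m (λ j → (m C suc j) * a (suc j)))
    ≡⟨ cong (1 * a 0 +_) (ℕP.+-comm B _) ⟩
  1 * a 0 + (∑< m (λ j → (m C suc j) * a (suc j)) + B)
    ≡⟨ sym (+-assoc (1 * a 0) _ B) ⟩
  ∑< (suc m) (λ j → (m C j) * a j) + B ∎
  where
  B = ∑< (suc m) (λ j → (m C j) * a (suc j))
  pascal : ∀ j → (suc m C suc j) * a (suc j) ≡ (m C j) * a (suc j) + (m C suc j) * a (suc j)
  pascal j = trans (cong (_* a (suc j)) (sym (nCk+nC[k+1]≡[n+1]C[k+1] m j))) (ℕP.*-distribʳ-+ (a (suc j)) (m C j) _)

∏< : ℕ → (ℕ → ℕ) → ℕ
∏< zero    f = 1
∏< (suc N) f = f 0 * ∏< N (f ∘ suc)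

product-applyUpTo : (f g : ℕ → ℕ) (N : ℕ) → product (map f (applyUpTo g N)) ≡ ∏< N (f ∘ g)
product-applyUpTo f g zero    = refl
product-applyUpTo f g (suc N) = cong (f (g 0) *_) (product-applyUpTo f (g ∘ suc) N)

∏<-cong : (N : ℕ) {f g : ℕ → ℕ} → (∀ j → f j ≡ g j) → ∏< N f ≡ ∏< N g
∏<-cong zero    f≗g = refl
∏<-cong (suc N) f≗g = cong₂ _*_ (f≗g 0) (∏<-cong N (f≗g ∘ suc))

∏<-1 : (N : ℕ) → ∏< N (λ _ → 1) ≡ 1
∏<-1 zero    = refl
∏<-1 (suc N) = trans (+-identityʳ _) (∏<-1 N)

∏<-scale-at : (N s k : ℕ) (f g : ℕ → ℕ) → s < N → f s ≡ k * g s →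
              (∀ j → j ≢ s → f j ≡ g j) → ∏< N f ≡ k * ∏< N g
∏<-scale-at (suc N) zero k f g _ fs≡kgs f≗g = begin
  f 0 * ∏< N (f ∘ suc)     ≡⟨ cong₂ _*_ fs≡kgs (∏<-cong N (λ j → f≗g (suc j) λ ())) ⟩
  k * g 0 * ∏< N (g ∘ suc) ≡⟨ *-assoc k (g 0) _ ⟩
  k * ∏< (suc N) g         ∎
∏<-scale-at (suc N) (suc s) k f g (s≤s s<N) fs≡kgs f≗g = begin
  f 0 * ∏< N (f ∘ suc)       ≡⟨ cong₂ _*_ (f≗g 0 λ ()) (∏<-scale-at N s k (f ∘ suc) (g ∘ suc) s<N fs≡kgs
                                  (λ j j≢s → f≗g (suc j) (j≢s ∘ ℕP.suc-injective))) ⟩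
  g 0 * (k * ∏< N (g ∘ suc)) ≡⟨ ℕP.*-comm (g 0) _ ⟩
  k * ∏< N (g ∘ suc) * g 0   ≡⟨ *-assoc k _ (g 0) ⟩
  k * (∏< N (g ∘ suc) * g 0) ≡⟨ cong (k *_) (ℕP.*-comm _ (g 0)) ⟩
  k * ∏< (suc N) g           ∎

-- Sorting and multiplicities

-- sortDesc is the standard library's insertion sort for ≥, so its correctness lemmas apply.
≥-decTotalOrder : DecTotalOrder _ _ _
≥-decTotalOrder = Flip.decTotalOrder ≤-decTotalOrder

module Sort≥ where
  open import Data.List.Sort.InsertionSort.Base ≥-decTotalOrder public using (insert; sort)
  open import Data.List.Sort.InsertionSort.Properties ≥-decTotalOrder public using (sort-↭; sort-↗)

insertDesc≡insert : ∀ x ys → insertDesc x ys ≡ Sort≥.insert x ys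
insertDesc≡insert x [] = refl
insertDesc≡insert x (y ∷ ys) with y ≤? x
... | yes y≤x = cong (λ b → if b then x ∷ y ∷ ys else y ∷ Sort≥.insert x ys) (sym (dec-true (y ≤? x) y≤x))
... | no y≰x  = trans (cong (y ∷_) (insertDesc≡insert x ys))
                      (cong (λ b → if b then x ∷ y ∷ ys else y ∷ Sort≥.insert x ys) (sym (dec-false (y ≤? x) y≰x)))

sortDesc≡sort : ∀ xs → sortDesc xs ≡ Sort≥.sort xs
sortDesc≡sort []       = refl
sortDesc≡sort (x ∷ xs) = trans (cong (insertDesc x) (sortDesc≡sort xs)) (insertDesc≡insert x (Sort≥.sort xs))

sortDesc-↭ : ∀ xs → sortDesc xs ↭ xs
sortDesc-↭ xs rewrite sortDesc≡sort xs = Sort≥.sort-↭ xs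

-- Two sorted permutations of each other coincide.
sortDesc-cong-↭ : ∀ {xs ys} → xs ↭ ys → sortDesc xs ≡ sortDesc ys
sortDesc-cong-↭ {xs} {ys} xs↭ys rewrite sortDesc≡sort xs | sortDesc≡sort ys =
  Pointwise-≡⇒≡ (↗↭↗⇒≋ (DecTotalOrder.totalOrder ≥-decTotalOrder) (Sort≥.sort-↗ xs) (Sort≥.sort-↗ ys)
    (↭⇒↭ₛ (↭-trans (Sort≥.sort-↭ xs) (↭-trans xs↭ys (↭-sym (Sort≥.sort-↭ ys))))))

sortDesc-idempotent : ∀ xs → sortDesc (sortDesc xs) ≡ sortDesc xs
sortDesc-idempotent xs = sortDesc-cong-↭ (sortDesc-↭ xs)

sortDesc-≡⇔↭ : ∀ xs ys → sortDesc xs ≡ sortDesc ys ⇔ (xs ↭ ys)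
sortDesc-≡⇔↭ xs ys = mk⇔
  (λ eq → ↭-trans (↭-sym (sortDesc-↭ xs)) (subst (_↭ ys) (sym eq) (sortDesc-↭ ys)))
  sortDesc-cong-↭

infix 3 _↭?_
_↭?_ : Decidable (_↭_ {A = ℕ})
xs ↭? ys = map′ (Equivalence.to (sortDesc-≡⇔↭ xs ys)) (Equivalence.from (sortDesc-≡⇔↭ xs ys))
                (ListP.≡-dec _≟_ (sortDesc xs) (sortDesc ys))

mult-here : ∀ g γ → mult (g ∷ γ) g ≡ suc (mult γ g)
mult-here g γ = cong length (ListP.filter-accept (_≟ g) {g} {γ} refl)

mult-there : ∀ g γ s → g ≢ s → mult (g ∷ γ) s ≡ mult γ s
mult-there g γ s g≢s = cong length (ListP.filter-reject (_≟ s) {g} {γ} g≢s)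

mult-↭ : ∀ {xs ys} → xs ↭ ys → (s : ℕ) → mult xs s ≡ mult ys s
mult-↭ xs↭ys s = ↭P.↭-length (↭P.filter-↭ (_≟ s) xs↭ys)

-- The paper's ∏_{s≥1} m_s(γ)!, computed recursively: putting g in front of γ multiplies the
-- factor for s = g by suc (mult γ g).
symmetries : List ℕ → ℕ
symmetries []      = 1
symmetries (g ∷ γ) = suc (mult γ g) * symmetries γ

∏<-mult! : (N : ℕ) (γ : List ℕ) → All (λ g → 1 ≤ g × g ≤ N) γ →
           ∏< N (λ s → mult γ (suc s) !) ≡ symmetries γ
∏<-mult! N []              _                 = ∏<-1 N
∏<-mult! N (suc s ∷ γ) ((_ , s<N) ∷ bounds) = begin
  ∏< N (λ j → mult (suc s ∷ γ) (suc j) !)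
    ≡⟨ ∏<-scale-at N s (suc (mult γ (suc s))) _ _ s<N (cong _! (mult-here (suc s) γ)) other ⟩
  suc (mult γ (suc s)) * ∏< N (λ j → mult γ (suc j) !)
    ≡⟨ cong (suc (mult γ (suc s)) *_) (∏<-mult! N γ bounds) ⟩
  symmetries (suc s ∷ γ) ∎
  where
  other : ∀ j → j ≢ s → mult (suc s ∷ γ) (suc j) ! ≡ mult γ (suc j) !
  other j j≢s = cong _! (mult-there (suc s) γ (suc j) (j≢s ∘ sym ∘ ℕP.suc-injective))

All-≤-sum : (γ : List ℕ) → All (_≤ sum γ) γ
All-≤-sum []      = []
All-≤-sum (g ∷ γ) =
  ℕP.m≤m+n g (sum γ) ∷ All.map (λ g′≤ → ℕP.≤-trans g′≤ (ℕP.m≤n+m (sum γ) g)) (All-≤-sum γ)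

multProd≡symmetries : (γ : List ℕ) → All (1 ≤_) γ → multProd γ ≡ symmetries γ
multProd≡symmetries γ pos = trans (product-applyUpTo (λ s → mult γ (suc s) !) (λ j → j) (sum γ))
                                  (∏<-mult! (sum γ) γ (All.zip (pos , All-≤-sum γ)))

-- Invariance of L under reordering and relabelling

module _ {A : Set} where

  unique-⊆∧⊇⇒↭ : {xs ys : List A} → Unique xs → Unique ys → xs ⊆ ys → ys ⊆ xs → xs ↭ ys
  unique-⊆∧⊇⇒↭ xs! ys! xs⊆ys ys⊆xs = ∼bag⇒↭ (unique∧set⇒bag xs! ys! (mk⇔ xs⊆ys ys⊆xs))

  All-sublists-∷⁻ : {P : List A → Set} (x : A) (xs : List A) →
                    All P (sublists (x ∷ xs)) → All P (sublists xs) × All (P ∘ (x ∷_)) (sublists xs)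
  All-sublists-∷⁻ x xs all = let (P-xs , P-x∷xs) = AllP.++⁻ (sublists xs) all in P-xs , AllP.map⁻ P-x∷xs

  All-sublists-∷⁺ : {P : List A → Set} (x : A) (xs : List A) →
                    All P (sublists xs) × All (P ∘ (x ∷_)) (sublists xs) → All P (sublists (x ∷ xs))
  All-sublists-∷⁺ x xs (P-xs , P-x∷xs) = AllP.++⁺ P-xs (AllP.map⁺ P-x∷xs)

  All-sublists-resp-↭ : {P : List A → Set} → (∀ {xs ys} → xs ↭ ys → P xs → P ys) →
                        ∀ {xs ys} → xs ↭ ys → All P (sublists xs) → All P (sublists ys)
  All-sublists-resp-↭ resp ↭.refl all = all
  All-sublists-resp-↭ resp (↭.prep {xs} {ys} x xs↭ys) all =
    let (P-xs , P-x∷xs) = All-sublists-∷⁻ x xs all in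
    All-sublists-∷⁺ x ys ( All-sublists-resp-↭ resp xs↭ys P-xs
                         , All-sublists-resp-↭ (resp ∘ ↭-prep x) xs↭ys P-x∷xs)
  All-sublists-resp-↭ {P} resp (↭.swap {xs} {ys} x y xs↭ys) all =
    let (P-y∷xs , P-x∷y∷xs) = All-sublists-∷⁻ x (y ∷ xs) all
        (P-xs , P-y∷·)      = All-sublists-∷⁻ y xs P-y∷xs
        (P-x∷· , P-x∷y∷·)   = All-sublists-∷⁻ y xs P-x∷y∷xs
    in All-sublists-∷⁺ y (x ∷ ys) (All-sublists-∷⁺ x ys (move resp P-xs , move (resp ∘ ↭-prep x) P-x∷·) ,
                        All-sublists-∷⁺ x ys (move (resp ∘ ↭-prep y) P-y∷· ,
                          All.map (resp (↭-swap x y ↭-refl)) (move (resp ∘ ↭-prep x ∘ ↭-prep y) P-x∷y∷·)))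
    where
    move : {Q : List A → Set} → (∀ {xs ys} → xs ↭ ys → Q xs → Q ys) →
           All Q (sublists xs) → All Q (sublists ys)
    move resp′ = All-sublists-resp-↭ resp′ xs↭ys
  All-sublists-resp-↭ resp (↭.trans xs↭ys ys↭zs) =
    All-sublists-resp-↭ resp ys↭zs ∘ All-sublists-resp-↭ resp xs↭ys

  sublists-⊆ : (xs : List A) → All (_⊆ xs) (sublists xs)
  sublists-⊆ []       = (λ ()) ∷ []
  sublists-⊆ (x ∷ xs) = AllP.++⁺ (All.map (λ ys⊆xs {y} y∈ → there (ys⊆xs y∈)) (sublists-⊆ xs))
                                 (AllP.map⁺ (All.map ∷-mono (sublists-⊆ xs)))
    where
    ∷-mono : ∀ {ys} → ys ⊆ xs → x ∷ ys ⊆ x ∷ xs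
    ∷-mono ys⊆xs (here x≡y) = here x≡y
    ∷-mono ys⊆xs (there y∈) = there (ys⊆xs y∈)

  sublists-unique : {xs : List A} → Unique xs → All Unique (sublists xs)
  sublists-unique {[]}     []          = [] ∷ []
  sublists-unique {x ∷ xs} (x∉xs ∷ xs!) =
    AllP.++⁺ (sublists-unique xs!)
             (AllP.map⁺ (All.zipWith {P = _⊆ xs} {Q = Unique} cons (sublists-⊆ xs , sublists-unique xs!)))
    where
    cons : ∀ {ys} → ys ⊆ xs × Unique ys → Unique (x ∷ ys)
    cons (ys⊆xs , ys!) = All.tabulate (All.lookup x∉xs ∘ ys⊆xs) ∷ ys!

module _ {n : ℕ} (d : ℕ) where

  D-resp-↭ : {T F : List (Subset n)} → T ↭ F → D d T ≡ D d F
  D-resp-↭ T↭F = cong₂ (λ X r → codim d X ℤ.- r)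
    (↭ₛP.foldr-commMonoid (setoid (Subset n)) (SubsetP.∩-isCommutativeMonoid n) (↭⇒↭ₛ T↭F))
    (↭ₛP.foldr-commMonoid (setoid ℤ.ℤ) ℤP.+-0-isCommutativeMonoid (↭⇒↭ₛ (↭P.map⁺ (codim d) T↭F)))

  InL-resp-↭ : {T F : List (Subset n)} → T ↭ F → InL d T → InL d F
  InL-resp-↭ T↭F (T! , small , positive) =
      ↭ₛP.Unique-resp-↭ (setoid (Subset n)) (↭⇒↭ₛ T↭F) T!
    , ↭P.All-resp-↭ T↭F small
    , All-sublists-resp-↭ D-positive T↭F positive
    where
    D-positive : ∀ {T′ F′ : List (Subset n)} → T′ ↭ F′ →
                 (1 < length T′ → ℤ.+ 0 ℤ.< D d T′) → 1 < length F′ → ℤ.+ 0 ℤ.< D d F′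
    D-positive T′↭F′ h 1<|F′| =
      subst (ℤ.+ 0 ℤ.<_) (D-resp-↭ T′↭F′) (h (subst (1 <_) (sym (↭P.↭-length T′↭F′)) 1<|F′|))

sublists-map : {A B : Set} (f : A → B) (xs : List A) → sublists (map f xs) ≡ map (map f) (sublists xs)
sublists-map f []       = refl
sublists-map f (x ∷ xs) rewrite sublists-map f xs =
  sym (trans (ListP.map-++ (map f) (sublists xs) _)
             (cong (map (map f) (sublists xs) ++_) (trans (sym (ListP.map-∘ (sublists xs))) (ListP.map-∘ (sublists xs)))))

module Embedding {m m′ : ℕ} (f : Subset m → Subset m′)
                 (f-card : ∀ X → ∣ f X ∣ ≡ ∣ X ∣)
                 (f-∩ : ∀ X Y → f (X ∩ Y) ≡ f X ∩ f Y)
                 (f-injective : ∀ {X Y} → f X ≡ f Y → X ≡ Y)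
                 (d : ℕ) where

  -- f need not preserve ⊤, so only nonempty intersections are transported.
  ⋂-map : (X : Subset m) (T : List (Subset m)) → ⋂ (map f (X ∷ T)) ≡ f (⋂ (X ∷ T))
  ⋂-map X []      = trans (SubsetP.∩-identityʳ (f X)) (cong f (sym (SubsetP.∩-identityʳ X)))
  ⋂-map X (Y ∷ T) = trans (cong (f X ∩_) (⋂-map Y T)) (sym (f-∩ X _))

  codim-map : (X : Subset m) → codim d (f X) ≡ codim d X
  codim-map X = cong (λ k → ℤ.+ (d + 1) ℤ.- ℤ.+ k) (f-card X)

  ρ-map : (T : List (Subset m)) → ρ d (map f T) ≡ ρ d T
  ρ-map []      = refl
  ρ-map (X ∷ T) = cong₂ ℤ._+_ (codim-map X) (ρ-map T)

  D-map : (T : List (Subset m)) → 1 < length T → D d (map f T) ≡ D d T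
  D-map (X ∷ T) _ = cong₂ ℤ._-_ (trans (cong (codim d) (⋂-map X T)) (codim-map (⋂ (X ∷ T)))) (ρ-map (X ∷ T))

  codims-map : (T : List (Subset m)) → map (codimℕ d) (map f T) ≡ map (codimℕ d) T
  codims-map T = trans (sym (ListP.map-∘ T)) (ListP.map-cong (λ X → cong (d + 1 ∸_) (f-card X)) T)

  InL-map : (T : List (Subset m)) → InL d (map f T) ⇔ InL d T
  InL-map T = mk⇔
    (λ (fT! , small , positive) →
        UniqueP.map⁻ fT!
      , All.map (subst (_≤ d) (f-card _)) (AllP.map⁻ small)
      , All.map (λ {T′} h 1<|T′| → subst (ℤ.+ 0 ℤ.<_) (D-map T′ 1<|T′|)
                                      (h (subst (1 <_) (sym (ListP.length-map f T′)) 1<|T′|)))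
                (AllP.map⁻ (subst (All _) (sublists-map f T) positive)))
    (λ (T! , small , positive) →
        UniqueP.map⁺ f-injective T!
      , AllP.map⁺ (All.map (subst (_≤ d) (sym (f-card _))) small)
      , subst (All _) (sym (sublists-map f T))
          (AllP.map⁺ (All.map (λ {T′} h 1<|fT′| → let 1<|T′| = subst (1 <_) (ListP.length-map f T′) 1<|fT′| in
                                 subst (ℤ.+ 0 ℤ.<_) (sym (D-map T′ 1<|T′|)) (h 1<|T′|)) positive)))

insertAt-injective : {A : Set} {m : ℕ} (i : Fin (suc m)) (v : A) {X Y : Vec A m} →
                     insertAt X i v ≡ insertAt Y i v → X ≡ Y
insertAt-injective i v {X} {Y} eq =
  trans (sym (VecP.removeAt-insertAt X i v)) (trans (cong (λ Z → removeAt Z i) eq) (VecP.removeAt-insertAt Y i v))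

insertOutsideAt : ∀ {m} → Fin (suc m) → Subset m → Subset (suc m)
insertOutsideAt i X = insertAt X i outside

insertOutsideAt-card : ∀ {m} (i : Fin (suc m)) (X : Subset m) → ∣ insertOutsideAt i X ∣ ≡ ∣ X ∣
insertOutsideAt-card zero    X             = refl
insertOutsideAt-card (suc i) (inside ∷ X)  = cong suc (insertOutsideAt-card i X)
insertOutsideAt-card (suc i) (outside ∷ X) = insertOutsideAt-card i X

insertOutsideAt-∩ : ∀ {m} (i : Fin (suc m)) (X Y : Subset m) →
                    insertOutsideAt i (X ∩ Y) ≡ insertOutsideAt i X ∩ insertOutsideAt i Y
insertOutsideAt-∩ zero    X       Y       = refl
insertOutsideAt-∩ (suc i) (x ∷ X) (y ∷ Y) = cong ((x ∧ y) ∷_) (insertOutsideAt-∩ i X Y)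

-- Orderings of a family

module _ {A : Set} where

  tuplesOver : List A → List ℕ → List (List A)
  tuplesOver U []      = [] ∷ []
  tuplesOver U (_ ∷ γ) = concatMap (λ X → map (X ∷_) (tuplesOver U γ)) U

  ∑-tuplesOver-∷ : (U : List A) (g : ℕ) (γ : List ℕ) (f : List A → ℕ) →
                   ∑ f (tuplesOver U (g ∷ γ)) ≡ ∑ (λ t → ∑ (f ∘ (t ∷_)) (tuplesOver U γ)) U
  ∑-tuplesOver-∷ U g γ f = trans (∑-concatMap f (λ X → map (X ∷_) (tuplesOver U γ)) U)
                                 (∑-cong U (λ t _ → ∑-map f (t ∷_) (tuplesOver U γ)))

  ∈-tuplesOver⁻ : (U : List A) (γ : List ℕ) {T : List A} → T ∈ tuplesOver U γ → length T ≡ length γ × T ⊆ U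
  ∈-tuplesOver⁻ U [] (here refl) = refl , λ ()
  ∈-tuplesOver⁻ U (g ∷ γ) T∈ with find (∈-concatMap⁻ (λ X → map (X ∷_) (tuplesOver U γ)) {xs = U} T∈)
  ... | t , t∈U , t∷T′∈ with ∈-map⁻ (t ∷_) t∷T′∈
  ... | T′ , T′∈ , refl with ∈-tuplesOver⁻ U γ T′∈
  ... | |T′|≡|γ| , T′⊆U = cong suc |T′|≡|γ| , λ { (here refl) → t∈U ; (there x∈) → T′⊆U x∈ }

tuples≡tuplesOver : (j : ℕ) (γ : List ℕ) → tuples j γ ≡ tuplesOver (subsets j) γ
tuples≡tuplesOver j []      = refl
tuples≡tuplesOver j (g ∷ γ) = cong (λ Ts → concatMap (λ X → map (X ∷_) Ts) (subsets j)) (tuples≡tuplesOver j γ)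

subsets-unique : ∀ m → Unique (subsets m)
subsets-unique zero    = [] ∷ []
subsets-unique (suc m) =
  UniqueP.++⁺ (UniqueP.map⁺ VecP.∷-injectiveʳ (subsets-unique m)) (UniqueP.map⁺ VecP.∷-injectiveʳ (subsets-unique m))
    (λ (∈₀ , ∈₁) → case ∈-map⁻ (outside ∷_) ∈₀ , ∈-map⁻ (inside ∷_) ∈₁ of λ where
      ((_ , _ , refl) , (_ , _ , ())))

module Orderings {A : Set} (_≟A_ : DecidableEquality A) where

  open import Data.List.Membership.DecPropositional _≟A_ using (_∈?_)

  SameMembers : List A → List A → Set
  SameMembers T F = All (_∈ F) T × All (_∈ T) F

  sameMembers? : ∀ T F → Dec (SameMembers T F)
  sameMembers? T F = All.all? (_∈? F) T ×-dec All.all? (_∈? T) F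

  remove : A → List A → List A
  remove t = filter (λ x → ¬? (x ≟A t))

  ∈-remove⁺ : ∀ {t x F} → x ∈ F → x ≢ t → x ∈ remove t F
  ∈-remove⁺ = ∈-filter⁺ (λ x → ¬? (x ≟A _))

  ∈-remove⁻ : ∀ {t x F} → x ∈ remove t F → x ∈ F × x ≢ t
  ∈-remove⁻ {t} = ∈-filter⁻ (λ x → ¬? (x ≟A t))

  remove-unique : ∀ {t F} → Unique F → Unique (remove t F)
  remove-unique {t} = UniqueP.filter⁺ (λ x → ¬? (x ≟A t))

  ↭-remove : ∀ {t F} → Unique F → t ∈ F → F ↭ t ∷ remove t F
  ↭-remove {t} {F} F! t∈F = unique-⊆∧⊇⇒↭ F! t∷F′! F⊆t∷F′ t∷F′⊆F
    where
    t∷F′! : Unique (t ∷ remove t F)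
    t∷F′! = All.tabulate (λ x∈ t≡x → proj₂ (∈-remove⁻ {F = F} x∈) (sym t≡x)) ∷ remove-unique F!
    F⊆t∷F′ : F ⊆ t ∷ remove t F
    F⊆t∷F′ {x} x∈F with x ≟A t
    ... | yes x≡t = here x≡t
    ... | no x≢t  = there (∈-remove⁺ x∈F x≢t)
    t∷F′⊆F : t ∷ remove t F ⊆ F
    t∷F′⊆F (here refl) = t∈F
    t∷F′⊆F (there x∈)  = proj₁ (∈-remove⁻ {F = F} x∈)

  ∑-restrict : {U F : List A} (h : A → ℕ) → Unique U → Unique F → F ⊆ U →
               ∑ (λ t → 𝟙 (t ∈? F) * h t) U ≡ ∑ h F
  ∑-restrict {U} {F} h U! F! F⊆U = trans (∑-filter (_∈? F) h U) (∑-↭ h filter↭F)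
    where
    filter↭F : filter (_∈? F) U ↭ F
    filter↭F = unique-⊆∧⊇⇒↭ (UniqueP.filter⁺ (_∈? F) U!) F!
      (proj₂ ∘ ∈-filter⁻ (_∈? F) {xs = U}) (λ x∈F → ∈-filter⁺ (_∈? F) (F⊆U x∈F) x∈F)

  sameMembers-∷ : ∀ {u T F} → u ∈ T → u ∉ F → SameMembers T (u ∷ F) ⇔ SameMembers (remove u T) F
  sameMembers-∷ {u} {T} {F} u∈T u∉F = mk⇔
    (λ (T⊆u∷F , u∷F⊆T) →
        All.tabulate (λ x∈ → let (x∈T , x≢u) = ∈-remove⁻ {F = T} x∈ in
                              Any.tail x≢u (All.lookup T⊆u∷F x∈T))
      , All.tabulate (λ {x} x∈F → ∈-remove⁺ (All.lookup u∷F⊆T (there x∈F))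
                                            (λ x≡u → u∉F (subst (_∈ F) x≡u x∈F))))
    (λ (T′⊆F , F⊆T′) →
        All.tabulate (λ {x} x∈T → case x ≟A u of λ where
          (yes x≡u) → here x≡u
          (no x≢u)  → there (All.lookup T′⊆F (∈-remove⁺ x∈T x≢u)))
      , u∈T ∷ All.map (λ x∈ → proj₁ (∈-remove⁻ {F = T} x∈)) F⊆T′)

  ∑-sameMembers-sublists : (U T : List A) → Unique U → T ⊆ U → ∑ (𝟙 ∘ sameMembers? T) (sublists U) ≡ 1
  ∑-sameMembers-sublists []      []      _            _     = refl
  ∑-sameMembers-sublists []      (x ∷ T) _            T⊆[]  with () ← T⊆[] (here refl)
  ∑-sameMembers-sublists (u ∷ U) T       (u∉U ∷ U!)   T⊆u∷U = begin
    ∑ (𝟙 ∘ sameMembers? T) (sublists U ++ map (u ∷_) (sublists U))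
      ≡⟨ ∑-++ _ (sublists U) _ ⟩
    ∑ (𝟙 ∘ sameMembers? T) (sublists U) + ∑ (𝟙 ∘ sameMembers? T) (map (u ∷_) (sublists U))
      ≡⟨ cong (∑ (𝟙 ∘ sameMembers? T) (sublists U) +_) (∑-map _ (u ∷_) (sublists U)) ⟩
    ∑ (𝟙 ∘ sameMembers? T) (sublists U) + ∑ (𝟙 ∘ sameMembers? T ∘ (u ∷_)) (sublists U)
      ≡⟨ by-cases (u ∈? T) ⟩
    1 ∎
    where
    u∉F : ∀ {F} → F ∈ sublists U → u ∉ F
    u∉F F∈ u∈F = All.lookup u∉U (All.lookup (sublists-⊆ U) F∈ u∈F) refl
    by-cases : Dec (u ∈ T) →
      ∑ (𝟙 ∘ sameMembers? T) (sublists U) + ∑ (𝟙 ∘ sameMembers? T ∘ (u ∷_)) (sublists U) ≡ 1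
    by-cases (yes u∈T) = cong₂ _+_
      (∑-vanishes (sublists U) (λ F F∈ → 𝟙-no _ (λ (T⊆F , _) → u∉F F∈ (All.lookup T⊆F u∈T))))
      (trans (∑-cong (sublists U) (λ F F∈ → 𝟙-cong _ _ (sameMembers-∷ u∈T (u∉F F∈))))
             (∑-sameMembers-sublists U (remove u T) U!
               (λ x∈ → let (x∈T , x≢u) = ∈-remove⁻ {F = T} x∈ in Any.tail x≢u (T⊆u∷U x∈T))))
    by-cases (no u∉T) = cong₂ _+_
      (∑-sameMembers-sublists U T U!
        (λ x∈T → Any.tail (λ x≡u → u∉T (subst (_∈ T) x≡u x∈T)) (T⊆u∷U x∈T)))
      (∑-vanishes (sublists U) (λ F _ → 𝟙-no _ (λ (_ , u∷F⊆T) → u∉T (All.lookup u∷F⊆T (here refl)))))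

  module _ (c : A → ℕ) where

    IsOrdering : List A → List ℕ → List A → Set
    IsOrdering F γ T = Unique T × SameMembers T F × map c T ≡ γ

    isOrdering? : ∀ F γ T → Dec (IsOrdering F γ T)
    isOrdering? F γ T = UniqueDec.unique? _≟A_ T ×-dec sameMembers? T F ×-dec ListP.≡-dec _≟_ (map c T) γ

    isOrdering-∷ : ∀ {F g γ t T} →
                   IsOrdering F (g ∷ γ) (t ∷ T) ⇔ (t ∈ F × c t ≡ g × IsOrdering (remove t F) γ T)
    isOrdering-∷ {F} {g} {γ} {t} {T} = mk⇔
      (λ { ((t∉T ∷ T!) , (t∈F ∷ T⊆F , F⊆t∷T) , c[t∷T]≡g∷γ) →
          t∈F , ListP.∷-injectiveˡ c[t∷T]≡g∷γ , T!
        , ( All.zipWith (λ (x∈F , t≢x) → ∈-remove⁺ x∈F (t≢x ∘ sym)) (T⊆F , t∉T)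
          , All.tabulate (λ x∈ → let (x∈F , x≢t) = ∈-remove⁻ {F = F} x∈ in
                                  Any.tail x≢t (All.lookup F⊆t∷T x∈F)))
        , ListP.∷-injectiveʳ c[t∷T]≡g∷γ })
      (λ (t∈F , ct≡g , T! , (T⊆F′ , F′⊆T) , cT≡γ) →
          (All.map (λ x∈ t≡x → proj₂ (∈-remove⁻ {F = F} x∈) (sym t≡x)) T⊆F′ ∷ T!)
        , ( t∈F ∷ All.map (λ x∈ → proj₁ (∈-remove⁻ {F = F} x∈)) T⊆F′
          , All.tabulate (λ {x} x∈F → case x ≟A t of λ where
              (yes x≡t) → here x≡t
              (no x≢t)  → there (All.lookup F′⊆T (∈-remove⁺ x∈F x≢t))))
        , cong₂ _∷_ ct≡g cT≡γ)

    mult-map : (F : List A) (g : ℕ) → mult (map c F) g ≡ ∑ (λ t → 𝟙 (c t ≟ g)) F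
    mult-map F g = trans (length-filter≡∑𝟙 (_≟ g) (map c F)) (∑-map (𝟙 ∘ (_≟ g)) c F)

    ∑-orderings : {U : List A} → Unique U → (γ : List ℕ) {F : List A} → Unique F → F ⊆ U →
                  ∑ (𝟙 ∘ isOrdering? F γ) (tuplesOver U γ) ≡ 𝟙 (map c F ↭? γ) * symmetries γ
    ∑-orderings U! [] {F} F! F⊆U =
      trans (+-identityʳ _) (trans (𝟙-cong (isOrdering? F [] []) (map c F ↭? []) (only-empty F)) (sym (*-identityʳ _)))
      where
      only-empty : ∀ F → IsOrdering F [] [] ⇔ (map c F ↭ [])
      only-empty []      = mk⇔ (λ _ → ↭-refl) (λ _ → [] , ([] , []) , refl)
      only-empty (x ∷ F) = mk⇔ (λ { (_ , (_ , () ∷ _) , _) }) (λ p → case ↭P.↭-empty-inv p of λ ())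
    ∑-orderings {U} U! (g ∷ γ) {F} F! F⊆U = begin
      ∑ (𝟙 ∘ isOrdering? F (g ∷ γ)) (tuplesOver U (g ∷ γ))
        ≡⟨ ∑-tuplesOver-∷ U g γ _ ⟩
      ∑ (λ t → ∑ (λ T → 𝟙 (isOrdering? F (g ∷ γ) (t ∷ T))) (tuplesOver U γ)) U
        ≡⟨ ∑-cong U (λ t _ → first-entry t) ⟩
      ∑ (λ t → 𝟙 (t ∈? F) * (𝟙 (c t ≟ g) * (𝟙 (map c (remove t F) ↭? γ) * symmetries γ))) U
        ≡⟨ ∑-restrict _ U! F! F⊆U ⟩
      ∑ (λ t → 𝟙 (c t ≟ g) * (𝟙 (map c (remove t F) ↭? γ) * symmetries γ)) F
        ≡⟨ ∑-cong F (λ t t∈F → rest-of-F t t∈F (c t ≟ g)) ⟩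
      ∑ (λ t → 𝟙 (c t ≟ g) * (𝟙 (map c F ↭? g ∷ γ) * symmetries γ)) F
        ≡⟨ ∑-*ʳ _ (λ t → 𝟙 (c t ≟ g)) F ⟩
      ∑ (λ t → 𝟙 (c t ≟ g)) F * (𝟙 (map c F ↭? g ∷ γ) * symmetries γ)
        ≡⟨ cong (_* (𝟙 (map c F ↭? g ∷ γ) * symmetries γ)) (sym (mult-map F g)) ⟩
      mult (map c F) g * (𝟙 (map c F ↭? g ∷ γ) * symmetries γ)
        ≡⟨ count-first (map c F ↭? g ∷ γ) ⟩
      𝟙 (map c F ↭? g ∷ γ) * symmetries (g ∷ γ) ∎
      where
      first-entry : ∀ t → ∑ (λ T → 𝟙 (isOrdering? F (g ∷ γ) (t ∷ T))) (tuplesOver U γ)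
                          ≡ 𝟙 (t ∈? F) * (𝟙 (c t ≟ g) * (𝟙 (map c (remove t F) ↭? γ) * symmetries γ))
      first-entry t = begin
        ∑ (λ T → 𝟙 (isOrdering? F (g ∷ γ) (t ∷ T))) (tuplesOver U γ)
          ≡⟨ ∑-cong (tuplesOver U γ) (λ T _ →
               trans (𝟙-cong _ (t ∈? F ×-dec c t ≟ g ×-dec isOrdering? (remove t F) γ T) isOrdering-∷)
                     (trans (𝟙-× (t ∈? F) _) (cong (𝟙 (t ∈? F) *_) (𝟙-× (c t ≟ g) _)))) ⟩
        ∑ (λ T → 𝟙 (t ∈? F) * (𝟙 (c t ≟ g) * 𝟙 (isOrdering? (remove t F) γ T))) (tuplesOver U γ)
          ≡⟨ ∑-*ˡ (𝟙 (t ∈? F)) _ (tuplesOver U γ) ⟩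
        𝟙 (t ∈? F) * ∑ (λ T → 𝟙 (c t ≟ g) * 𝟙 (isOrdering? (remove t F) γ T)) (tuplesOver U γ)
          ≡⟨ cong (𝟙 (t ∈? F) *_) (∑-*ˡ (𝟙 (c t ≟ g)) _ (tuplesOver U γ)) ⟩
        𝟙 (t ∈? F) * (𝟙 (c t ≟ g) * ∑ (𝟙 ∘ isOrdering? (remove t F) γ) (tuplesOver U γ))
          ≡⟨ cong (λ z → 𝟙 (t ∈? F) * (𝟙 (c t ≟ g) * z))
                  (∑-orderings U! γ (remove-unique F!) (λ x∈ → F⊆U (proj₁ (∈-remove⁻ {F = F} x∈)))) ⟩
        𝟙 (t ∈? F) * (𝟙 (c t ≟ g) * (𝟙 (map c (remove t F) ↭? γ) * symmetries γ)) ∎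
      rest-of-F : ∀ t → t ∈ F → (ct≟g : Dec (c t ≡ g)) →
                  𝟙 ct≟g * (𝟙 (map c (remove t F) ↭? γ) * symmetries γ)
                  ≡ 𝟙 ct≟g * (𝟙 (map c F ↭? g ∷ γ) * symmetries γ)
      rest-of-F t t∈F (no _)     = refl
      rest-of-F t t∈F (yes ct≡g) = cong (λ z → 1 * (z * symmetries γ))
        (𝟙-cong (map c (remove t F) ↭? γ) (map c F ↭? g ∷ γ) (mk⇔
        (λ p → ↭-trans F↭ct∷F′ (subst (λ h → h ∷ _ ↭ g ∷ γ) (sym ct≡g) (↭-prep g p)))
        (λ q → ↭P.drop-∷ (subst (λ h → h ∷ _ ↭ g ∷ γ) ct≡g (↭-trans (↭-sym F↭ct∷F′) q)))))
        where
        F↭ct∷F′ : map c F ↭ c t ∷ map c (remove t F)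
        F↭ct∷F′ = ↭P.map⁺ c (↭-remove F! t∈F)
      count-first : (p? : Dec (map c F ↭ g ∷ γ)) →
                    mult (map c F) g * (𝟙 p? * symmetries γ) ≡ 𝟙 p? * symmetries (g ∷ γ)
      count-first (no _)  = *-zeroʳ (mult (map c F) g)
      count-first (yes p) = begin
        mult (map c F) g * (1 * symmetries γ)
          ≡⟨ cong₂ _*_ (trans (mult-↭ p g) (mult-here g γ)) (ℕP.*-identityˡ _) ⟩
        suc (mult γ g) * symmetries γ
          ≡⟨ sym (ℕP.*-identityˡ _) ⟩
        1 * symmetries (g ∷ γ) ∎

-- Splitting off the first point

-- Missing entries of a short column count as outside.
prependColumn : ∀ {m} → List Bool → List (Subset m) → List (Subset (suc m))
prependColumn bs       []      = []
prependColumn []       (X ∷ T) = (outside ∷ X) ∷ prependColumn [] T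
prependColumn (b ∷ bs) (X ∷ T) = (b ∷ X) ∷ prependColumn bs T

pointCovered : ∀ {m} → List Bool → List (Subset m) → Bool
pointCovered bs       []      = false
pointCovered []       (_ ∷ T) = pointCovered [] T
pointCovered (b ∷ bs) (_ ∷ T) = b ∨ pointCovered bs T

⋃-prependColumn : ∀ {m} (x : List Bool) (T : List (Subset m)) → ⋃ (prependColumn x T) ≡ pointCovered x T ∷ ⋃ T
⋃-prependColumn x       []      = refl
⋃-prependColumn []      (X ∷ T) = cong (λ Y → (outside ∷ X) ∪ Y) (⋃-prependColumn [] T)
⋃-prependColumn (b ∷ x) (X ∷ T) = cong (λ Y → (b ∷ X) ∪ Y) (⋃-prependColumn x T)

prependColumn-insertOutsideAt : ∀ {m} (x : List Bool) (i : Fin (suc m)) (T : List (Subset m)) →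
  prependColumn x (map (insertOutsideAt i) T) ≡ map (insertOutsideAt (suc i)) (prependColumn x T)
prependColumn-insertOutsideAt x       i []      = refl
prependColumn-insertOutsideAt []      i (X ∷ T) = cong (_ ∷_) (prependColumn-insertOutsideAt [] i T)
prependColumn-insertOutsideAt (b ∷ x) i (X ∷ T) = cong (_ ∷_) (prependColumn-insertOutsideAt x i T)

zeroColumn : List ℕ → List Bool
zeroColumn = map (λ _ → outside)

prependColumn-zeroColumn : ∀ {m} (γ : List ℕ) (T : List (Subset m)) →
                           prependColumn (zeroColumn γ) T ≡ map (insertOutsideAt zero) T
prependColumn-zeroColumn γ       []      = refl
prependColumn-zeroColumn []      (X ∷ T) = cong (_ ∷_) (prependColumn-zeroColumn [] T)
prependColumn-zeroColumn (g ∷ γ) (X ∷ T) = cong (_ ∷_) (prependColumn-zeroColumn γ T)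

pointCovered-zeroColumn : ∀ {m} (γ : List ℕ) (T : List (Subset m)) → pointCovered (zeroColumn γ) T ≡ false
pointCovered-zeroColumn γ       []      = refl
pointCovered-zeroColumn []      (X ∷ T) = pointCovered-zeroColumn [] T
pointCovered-zeroColumn (g ∷ γ) (X ∷ T) = pointCovered-zeroColumn γ T

pointCovered-true : ∀ {m} (x : List Bool) (T : List (Subset m)) →
                    true ∈ x → length x ≡ length T → pointCovered x T ≡ true
pointCovered-true (true  ∷ x) (X ∷ T) _              _ = refl
pointCovered-true (false ∷ x) (X ∷ T) (there true∈x) |x|≡|T| =
  pointCovered-true x T true∈x (ℕP.suc-injective |x|≡|T|)

columns nonzeroColumns : List ℕ → List (List Bool)
columns γ = zeroColumn γ ∷ nonzeroColumns γ
nonzeroColumns []      = []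
nonzeroColumns (_ ∷ γ) = map (false ∷_) (nonzeroColumns γ) ++ map (true ∷_) (columns γ)

∈-columns⁻ : (γ : List ℕ) {x : List Bool} → x ∈ columns γ → length x ≡ length γ
∈-columns⁻ γ       (here refl) = ListP.length-map _ γ
∈-columns⁻ (g ∷ γ) (there x∈) with ListMemP.∈-++⁻ (map (false ∷_) (nonzeroColumns γ)) x∈
... | inj₁ x∈₀ with ∈-map⁻ (false ∷_) x∈₀
...   | _ , x′∈ , refl = cong suc (∈-columns⁻ γ (there x′∈))
∈-columns⁻ (g ∷ γ) (there x∈) | inj₂ x∈₁ with ∈-map⁻ (true ∷_) x∈₁
...   | _ , x′∈ , refl = cong suc (∈-columns⁻ γ x′∈)

∈-nonzeroColumns⁻ : (γ : List ℕ) {x : List Bool} → x ∈ nonzeroColumns γ → true ∈ x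
∈-nonzeroColumns⁻ (g ∷ γ) x∈ with ListMemP.∈-++⁻ (map (false ∷_) (nonzeroColumns γ)) x∈
... | inj₁ x∈₀ with ∈-map⁻ (false ∷_) x∈₀
...   | _ , x′∈ , refl = there (∈-nonzeroColumns⁻ γ x′∈)
∈-nonzeroColumns⁻ (g ∷ γ) x∈ | inj₂ x∈₁ with ∈-map⁻ (true ∷_) x∈₁
...   | _ , _ , refl = here refl

∑-columns-∷ : (g : ℕ) (γ : List ℕ) (h : List Bool → ℕ) →
              ∑ h (columns (g ∷ γ)) ≡ ∑ (h ∘ (false ∷_)) (columns γ) + ∑ (h ∘ (true ∷_)) (columns γ)
∑-columns-∷ g γ h = trans (∑-++ h (map (false ∷_) (columns γ)) _)
                          (cong₂ _+_ (∑-map h (false ∷_) (columns γ)) (∑-map h (true ∷_) (columns γ)))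

∑-subsets-suc : (j : ℕ) (h : Subset (suc j) → ℕ) →
                ∑ h (subsets (suc j)) ≡ ∑ (h ∘ (outside ∷_)) (subsets j) + ∑ (h ∘ (inside ∷_)) (subsets j)
∑-subsets-suc j h = trans (∑-++ h (map (outside ∷_) (subsets j)) _)
                          (cong₂ _+_ (∑-map h (outside ∷_) (subsets j)) (∑-map h (inside ∷_) (subsets j)))

∑-tuples-∷ : (j g : ℕ) (γ : List ℕ) (f : List (Subset j) → ℕ) →
             ∑ f (tuples j (g ∷ γ)) ≡ ∑ (λ X → ∑ (f ∘ (X ∷_)) (tuples j γ)) (subsets j)
∑-tuples-∷ j g γ f = trans (∑-concatMap f (λ X → map (X ∷_) (tuples j γ)) (subsets j))
                           (∑-cong (subsets j) (λ X _ → ∑-map f (X ∷_) (tuples j γ)))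

-- An l-tuple of subsets of {0,…,j} is its first column together with an l-tuple of subsets of {1,…,j}.
∑-tuples-suc : (j : ℕ) (γ : List ℕ) (f : List (Subset (suc j)) → ℕ) →
               ∑ f (tuples (suc j) γ) ≡ ∑ (λ x → ∑ (f ∘ prependColumn x) (tuples j γ)) (columns γ)
∑-tuples-suc j []      f = sym (+-identityʳ _)
∑-tuples-suc j (g ∷ γ) f = begin
  ∑ f (tuples (suc j) (g ∷ γ))
    ≡⟨ ∑-tuples-∷ (suc j) g γ f ⟩
  ∑ F (subsets (suc j))
    ≡⟨ ∑-subsets-suc j F ⟩
  ∑ (F ∘ (outside ∷_)) (subsets j) + ∑ (F ∘ (inside ∷_)) (subsets j)
    ≡⟨ cong₂ _+_ (first-column false) (first-column true) ⟩
  ∑ (G ∘ (false ∷_)) (columns γ) + ∑ (G ∘ (true ∷_)) (columns γ)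
    ≡⟨ sym (∑-columns-∷ g γ G) ⟩
  ∑ G (columns (g ∷ γ)) ∎
  where
  F : Subset (suc j) → ℕ
  F X = ∑ (f ∘ (X ∷_)) (tuples (suc j) γ)
  G : List Bool → ℕ
  G x = ∑ (f ∘ prependColumn x) (tuples j (g ∷ γ))
  first-column : (b : Bool) → ∑ (F ∘ (b ∷_)) (subsets j) ≡ ∑ (G ∘ (b ∷_)) (columns γ)
  first-column b = begin
    ∑ (F ∘ (b ∷_)) (subsets j)
      ≡⟨ ∑-cong (subsets j) (λ X _ → ∑-tuples-suc j γ (f ∘ ((b ∷ X) ∷_))) ⟩
    ∑ (λ X → ∑ (λ x → ∑ (λ T → f ((b ∷ X) ∷ prependColumn x T)) (tuples j γ)) (columns γ)) (subsets j)
      ≡⟨ ∑-comm (λ X x → ∑ (λ T → f ((b ∷ X) ∷ prependColumn x T)) (tuples j γ)) (subsets j) (columns γ) ⟩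
    ∑ (λ x → ∑ (λ X → ∑ (λ T → f ((b ∷ X) ∷ prependColumn x T)) (tuples j γ)) (subsets j)) (columns γ)
      ≡⟨ ∑-cong (columns γ) (λ x _ → sym (∑-tuples-∷ j g γ (f ∘ prependColumn (b ∷ x)))) ⟩
    ∑ (G ∘ (b ∷_)) (columns γ) ∎

spanning? : ∀ {m} (T : List (Subset m)) → Dec (⋃ T ≡ ⊤)
spanning? T = ⋃ T ≟S ⊤

spanning-prependColumn : ∀ {m} (x : List Bool) (T : List (Subset m)) →
  pointCovered x T ≡ true → 𝟙 (spanning? (prependColumn x T)) ≡ 𝟙 (spanning? T)
spanning-prependColumn x T covered = 𝟙-cong (spanning? (prependColumn x T)) (spanning? T) (mk⇔
  (λ eq → VecP.∷-injectiveʳ (trans (sym (⋃-prependColumn x T)) eq))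
  (λ eq → trans (⋃-prependColumn x T) (cong₂ _∷_ covered eq)))

not-spanning-prependColumn : ∀ {m} (x : List Bool) (T : List (Subset m)) →
  pointCovered x T ≡ false → 𝟙 (spanning? (prependColumn x T)) ≡ 0
not-spanning-prependColumn x T uncovered = 𝟙-no (spanning? (prependColumn x T))
  (λ eq → case trans (sym uncovered) (VecP.∷-injectiveˡ (trans (sym (⋃-prependColumn x T)) eq)) of λ ())

Weight : Set
Weight = (m : ℕ) → List (Subset m) → ℕ

module SupportDecomposition (γ : List ℕ) where

  InsertionInvariant : Weight → Set
  InsertionInvariant W = ∀ m (i : Fin (suc m)) T → W (suc m) (map (insertOutsideAt i) T) ≡ W m T

  total : Weight → ℕ → ℕ
  total W m = ∑ (W m) (tuples m γ)

  spanningTotal : Weight → ℕ → ℕ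
  spanningTotal W j = ∑ (λ T → W j T * 𝟙 (spanning? T)) (tuples j γ)

  withColumn : List Bool → Weight → Weight
  withColumn x W m T = W (suc m) (prependColumn x T)

  withColumn-insertionInvariant : ∀ x W → InsertionInvariant W → InsertionInvariant (withColumn x W)
  withColumn-insertionInvariant x W inv m i T =
    trans (cong (W (suc (suc m))) (prependColumn-insertOutsideAt x i T)) (inv (suc m) (suc i) (prependColumn x T))

  total-suc : ∀ W m → total W (suc m)
                      ≡ total (withColumn (zeroColumn γ) W) m + ∑ (λ x → total (withColumn x W) m) (nonzeroColumns γ)
  total-suc W m = ∑-tuples-suc m γ (W (suc m))

  total-zeroColumn : ∀ W → InsertionInvariant W → ∀ m → total (withColumn (zeroColumn γ) W) m ≡ total W m
  total-zeroColumn W inv m =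
    ∑-cong (tuples m γ) (λ T _ → trans (cong (W (suc m)) (prependColumn-zeroColumn γ T)) (inv m zero T))

  -- Only nonzero first columns can produce a family covering the new point.
  spanningTotal-suc : ∀ W j →
                      spanningTotal W (suc j) ≡ ∑ (λ x → spanningTotal (withColumn x W) j) (nonzeroColumns γ)
  spanningTotal-suc W j = begin
    spanningTotal W (suc j)
      ≡⟨ ∑-tuples-suc j γ (λ T → W (suc j) T * 𝟙 (spanning? T)) ⟩
    ∑ (V (zeroColumn γ)) (tuples j γ) + ∑ (λ x → ∑ (V x) (tuples j γ)) (nonzeroColumns γ)
      ≡⟨ cong₂ _+_ (∑-vanishes (tuples j γ) zero-column) (∑-cong (nonzeroColumns γ) nonzero-column) ⟩
    ∑ (λ x → spanningTotal (withColumn x W) j) (nonzeroColumns γ) ∎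
    where
    V : List Bool → List (Subset j) → ℕ
    V x T = W (suc j) (prependColumn x T) * 𝟙 (spanning? (prependColumn x T))
    zero-column : ∀ T → T ∈ tuples j γ → V (zeroColumn γ) T ≡ 0
    zero-column T _ = trans (cong (W (suc j) (prependColumn (zeroColumn γ) T) *_)
                                  (not-spanning-prependColumn (zeroColumn γ) T (pointCovered-zeroColumn γ T)))
                            (*-zeroʳ (W (suc j) (prependColumn (zeroColumn γ) T)))
    nonzero-column : ∀ x → x ∈ nonzeroColumns γ → ∑ (V x) (tuples j γ) ≡ spanningTotal (withColumn x W) j
    nonzero-column x x∈ = ∑-cong (tuples j γ) (λ T T∈ → cong (W (suc j) (prependColumn x T) *_)
      (spanning-prependColumn x T (pointCovered-true x T (∈-nonzeroColumns⁻ γ x∈)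
        (trans (∈-columns⁻ γ (there x∈))
               (sym (proj₁ (∈-tuplesOver⁻ (subsets j) γ (subst (T ∈_) (tuples≡tuplesOver j γ) T∈))))))))

  total≡∑binomial : (m : ℕ) (W : Weight) → InsertionInvariant W →
                    total W m ≡ ∑< (suc m) (λ j → (m C j) * spanningTotal W j)
  total≡∑binomial zero W inv = begin
    total W 0
      ≡⟨ ∑-cong (tuples 0 γ) (λ T _ → sym (trans (cong (W 0 T *_) (𝟙-yes (spanning? T) (Subset0≡⊤ (⋃ T))))
                                                 (*-identityʳ _))) ⟩
    spanningTotal W 0
      ≡⟨ sym (trans (+-identityʳ _) (+-identityʳ _)) ⟩
    (0 C 0) * spanningTotal W 0 + 0 ∎
    where
    Subset0≡⊤ : (X : Subset 0) → X ≡ ⊤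
    Subset0≡⊤ [] = refl
  total≡∑binomial (suc m) W inv = begin
    total W (suc m)
      ≡⟨ total-suc W m ⟩
    total (withColumn (zeroColumn γ) W) m + ∑ (λ x → total (withColumn x W) m) (nonzeroColumns γ)
      ≡⟨ cong₂ _+_ (trans (total-zeroColumn W inv m) (total≡∑binomial m W inv))
                   (∑-cong (nonzeroColumns γ) (λ x _ →
                     total≡∑binomial m (withColumn x W) (withColumn-insertionInvariant x W inv))) ⟩
    ∑< (suc m) (λ j → (m C j) * spanningTotal W j)
      + ∑ (λ x → ∑< (suc m) (λ j → (m C j) * spanningTotal (withColumn x W) j)) (nonzeroColumns γ)
      ≡⟨ cong (∑< (suc m) (λ j → (m C j) * spanningTotal W j) +_) (begin
           ∑ (λ x → ∑< (suc m) (λ j → (m C j) * spanningTotal (withColumn x W) j)) (nonzeroColumns γ)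
             ≡⟨ ∑-∑< (suc m) (λ x j → (m C j) * spanningTotal (withColumn x W) j) (nonzeroColumns γ) ⟩
           ∑< (suc m) (λ j → ∑ (λ x → (m C j) * spanningTotal (withColumn x W) j) (nonzeroColumns γ))
             ≡⟨ ∑<-cong (suc m) (λ j → trans (∑-*ˡ (m C j) _ (nonzeroColumns γ))
                                             (cong ((m C j) *_) (sym (spanningTotal-suc W j)))) ⟩
           ∑< (suc m) (λ j → (m C j) * spanningTotal W (suc j)) ∎) ⟩
    ∑< (suc m) (λ j → (m C j) * spanningTotal W j) + ∑< (suc m) (λ j → (m C j) * spanningTotal W (suc j))
      ≡⟨ sym (∑<-binomial-suc m (spanningTotal W)) ⟩
    ∑< (suc (suc m)) (λ j → (suc m C j) * spanningTotal W j) ∎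

type-positive : ∀ {n} d (T : List (Subset n)) → InL d T → All (1 ≤_) (type d T)
type-positive d T (_ , small , _) =
  ↭P.All-resp-↭ (↭-sym (sortDesc-↭ (map (codimℕ d) T)))
    (AllP.map⁺ (All.map (λ {X} |X|≤d → subst (1 ≤_) (sym (ℕP.+-∸-comm 1 |X|≤d)) (ℕP.m≤n+m 1 (d ∸ ∣ X ∣)))
                        small))

module Counting (d : ℕ) (γ : List ℕ) where

  open SupportDecomposition γ

  codims≟γ : ∀ {m} (T : List (Subset m)) → Dec (map (codimℕ d) T ≡ γ)
  codims≟γ T = ListP.≡-dec _≟_ (map (codimℕ d) T) γ

  inLγ : Weight
  inLγ m T = 𝟙 (InL? d T ×-dec codims≟γ T)

  inLγ-insertionInvariant : InsertionInvariant inLγ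
  inLγ-insertionInvariant m i T =
    𝟙-cong (InL? d (map f T) ×-dec codims≟γ (map f T)) (InL? d T ×-dec codims≟γ T) (mk⇔
      (λ (inL , codims≡γ) → Equivalence.to (E.InL-map T) inL , trans (sym (E.codims-map T)) codims≡γ)
      (λ (inL , codims≡γ) → Equivalence.from (E.InL-map T) inL , trans (E.codims-map T) codims≡γ))
    where
    f = insertOutsideAt i
    module E = Embedding f (insertOutsideAt-card i) (insertOutsideAt-∩ i) (insertAt-injective i outside) d

  spanningTotal≡c : ∀ j → spanningTotal inLγ j ≡ c j d γ
  spanningTotal≡c j = sym (trans (length-filter≡∑𝟙 _ (tuples j γ)) (∑-cong (tuples j γ) (λ T _ → begin
    𝟙 (InL? d T ×-dec codims≟γ T ×-dec spanning? T)
      ≡⟨ 𝟙-× (InL? d T) _ ⟩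
    𝟙 (InL? d T) * 𝟙 (codims≟γ T ×-dec spanning? T)
      ≡⟨ cong (𝟙 (InL? d T) *_) (𝟙-× (codims≟γ T) _) ⟩
    𝟙 (InL? d T) * (𝟙 (codims≟γ T) * 𝟙 (spanning? T))
      ≡⟨ sym (*-assoc (𝟙 (InL? d T)) _ _) ⟩
    𝟙 (InL? d T) * 𝟙 (codims≟γ T) * 𝟙 (spanning? T)
      ≡⟨ cong (_* 𝟙 (spanning? T)) (sym (𝟙-× (InL? d T) (codims≟γ T))) ⟩
    inLγ j T * 𝟙 (spanning? T) ∎)))

  module _ (n : ℕ) where

    open Orderings (_≟S_ {n})

    U : List (Subset n)
    U = subsets n

    -- Exactly one family has the members of T, and membership in L only depends on the members.
    ∑-families-ordering : ∀ T → T ∈ tuplesOver U γ →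
                          ∑ (λ F → 𝟙 (InL? d F) * 𝟙 (isOrdering? (codimℕ d) F γ T)) (families n) ≡ inLγ n T
    ∑-families-ordering T T∈ = begin
      ∑ (λ F → 𝟙 (InL? d F) * 𝟙 (isOrdering? (codimℕ d) F γ T)) (families n)
        ≡⟨ ∑-cong (families n) (λ F F∈ → same-members F F∈ (sameMembers? T F)) ⟩
      ∑ (λ F → 𝟙 (sameMembers? T F) * inLγ n T) (families n)
        ≡⟨ ∑-*ʳ (inLγ n T) (𝟙 ∘ sameMembers? T) (families n) ⟩
      ∑ (𝟙 ∘ sameMembers? T) (families n) * inLγ n T
        ≡⟨ cong (_* inLγ n T) (∑-sameMembers-sublists U T (subsets-unique n) (proj₂ (∈-tuplesOver⁻ U γ T∈))) ⟩
      1 * inLγ n T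
        ≡⟨ ℕP.*-identityˡ (inLγ n T) ⟩
      inLγ n T ∎
      where
      same-members : ∀ F → F ∈ families n → (sm? : Dec (SameMembers T F)) →
                     𝟙 (InL? d F) * 𝟙 (isOrdering? (codimℕ d) F γ T) ≡ 𝟙 sm? * inLγ n T
      same-members F F∈ (no ¬sm) =
        trans (cong (𝟙 (InL? d F) *_) (𝟙-no _ (λ (_ , sm , _) → ¬sm sm))) (*-zeroʳ (𝟙 (InL? d F)))
      same-members F F∈ (yes sm) = begin
        𝟙 (InL? d F) * 𝟙 (isOrdering? (codimℕ d) F γ T)  ≡⟨ sym (𝟙-× (InL? d F) _) ⟩
        𝟙 (InL? d F ×-dec isOrdering? (codimℕ d) F γ T)  ≡⟨ 𝟙-cong _ (InL? d T ×-dec codims≟γ T) (mk⇔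
              (λ (inL , (T! , _ , codims≡γ)) → InL-resp-↭ d (↭-sym (T↭F T!)) inL , codims≡γ)
              (λ (inL , codims≡γ) → InL-resp-↭ d (T↭F (proj₁ inL)) inL , (proj₁ inL , sm , codims≡γ))) ⟩
        inLγ n T                                             ≡⟨ sym (+-identityʳ (inLγ n T)) ⟩
        1 * inLγ n T                                         ∎
        where
        T↭F : Unique T → T ↭ F
        T↭F T! = unique-⊆∧⊇⇒↭ T! (All.lookup (sublists-unique (subsets-unique n)) F∈)
                              (All.lookup (proj₁ sm)) (All.lookup (proj₂ sm))

    λnd*symmetries≡total : sortDesc γ ≡ γ → λnd n d γ * symmetries γ ≡ total inLγ n
    λnd*symmetries≡total γ-sorted = begin
      λnd n d γ * symmetries γ
        ≡⟨ cong (_* symmetries γ) (length-filter≡∑𝟙 _ (families n)) ⟩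
      ∑ (λ F → 𝟙 (InL? d F ×-dec type≟γ F)) (families n) * symmetries γ
        ≡⟨ sym (∑-*ʳ (symmetries γ) _ (families n)) ⟩
      ∑ (λ F → 𝟙 (InL? d F ×-dec type≟γ F) * symmetries γ) (families n)
        ≡⟨ ∑-cong (families n) (λ F F∈ → family F F∈) ⟩
      ∑ (λ F → ∑ (λ T → 𝟙 (InL? d F) * 𝟙 (isOrdering? (codimℕ d) F γ T)) (tuplesOver U γ)) (families n)
        ≡⟨ ∑-comm (λ F T → 𝟙 (InL? d F) * 𝟙 (isOrdering? (codimℕ d) F γ T)) (families n) (tuplesOver U γ) ⟩
      ∑ (λ T → ∑ (λ F → 𝟙 (InL? d F) * 𝟙 (isOrdering? (codimℕ d) F γ T)) (families n)) (tuplesOver U γ)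
        ≡⟨ ∑-cong (tuplesOver U γ) ∑-families-ordering ⟩
      ∑ (inLγ n) (tuplesOver U γ)
        ≡⟨ cong (∑ (inLγ n)) (sym (tuples≡tuplesOver n γ)) ⟩
      total inLγ n ∎
      where
      type≟γ : (F : List (Subset n)) → Dec (type d F ≡ γ)
      type≟γ F = ListP.≡-dec _≟_ (type d F) γ
      family : ∀ F → F ∈ families n →
               𝟙 (InL? d F ×-dec type≟γ F) * symmetries γ
               ≡ ∑ (λ T → 𝟙 (InL? d F) * 𝟙 (isOrdering? (codimℕ d) F γ T)) (tuplesOver U γ)
      family F F∈ = begin
        𝟙 (InL? d F ×-dec type≟γ F) * symmetries γ
          ≡⟨ cong (_* symmetries γ) (𝟙-× (InL? d F) (type≟γ F)) ⟩
        𝟙 (InL? d F) * 𝟙 (type≟γ F) * symmetries γ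
          ≡⟨ *-assoc (𝟙 (InL? d F)) _ _ ⟩
        𝟙 (InL? d F) * (𝟙 (type≟γ F) * symmetries γ)
          ≡⟨ cong (λ z → 𝟙 (InL? d F) * (z * symmetries γ)) (𝟙-cong (type≟γ F) (map (codimℕ d) F ↭? γ) (mk⇔
                (λ type≡γ → Equivalence.to (sortDesc-≡⇔↭ _ γ) (trans type≡γ (sym γ-sorted)))
                (λ codims↭γ → trans (Equivalence.from (sortDesc-≡⇔↭ _ γ) codims↭γ) γ-sorted))) ⟩
        𝟙 (InL? d F) * (𝟙 (map (codimℕ d) F ↭? γ) * symmetries γ)
          ≡⟨ cong (𝟙 (InL? d F) *_) (sym (∑-orderings (codimℕ d) (subsets-unique n) γ
                                            (All.lookup (sublists-unique (subsets-unique n)) F∈)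
                                            (All.lookup (sublists-⊆ U) F∈))) ⟩
        𝟙 (InL? d F) * ∑ (𝟙 ∘ isOrdering? (codimℕ d) F γ) (tuplesOver U γ)
          ≡⟨ sym (∑-*ˡ (𝟙 (InL? d F)) _ (tuplesOver U γ)) ⟩
        ∑ (λ T → 𝟙 (InL? d F) * 𝟙 (isOrdering? (codimℕ d) F γ T)) (tuplesOver U γ) ∎

proposition19 : (d k : ℕ) → 1 ≤ d → (γ : List ℕ) → 1 ≤ length γ
    → Σ (List (Subset (d + k + 1))) (λ T → InL d T × type d T ≡ γ)
    → λnd (d + k + 1) d γ * multProd γ
      ≡ Σ≤ (d + k + 1) (λ j → c j d γ * ((d + k + 1) C j))
proposition19 d k _ γ _ (T₀ , T₀∈L , typeT₀≡γ) = begin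
  λnd n d γ * multProd γ
    ≡⟨ cong (λnd n d γ *_) (multProd≡symmetries γ γ-positive) ⟩
  λnd n d γ * symmetries γ
    ≡⟨ λnd*symmetries≡total n γ-sorted ⟩
  total inLγ n
    ≡⟨ total≡∑binomial n inLγ inLγ-insertionInvariant ⟩
  ∑< (suc n) (λ j → (n C j) * spanningTotal inLγ j)
    ≡⟨ ∑<-cong (suc n) (λ j → trans (*-comm (n C j) (spanningTotal inLγ j)) (cong (_* (n C j)) (spanningTotal≡c j))) ⟩
  ∑< (suc n) (λ j → c j d γ * (n C j))
    ≡⟨ sym (Σ≤≡∑< n _) ⟩
  Σ≤ n (λ j → c j d γ * (n C j)) ∎
  where
  open Counting d γ
  open SupportDecomposition γ
  n = d + k + 1
  γ-positive : All (1 ≤_) γ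
  γ-positive = subst (All (1 ≤_)) typeT₀≡γ (type-positive d T₀ T₀∈L)
  γ-sorted : sortDesc γ ≡ γ
  γ-sorted = subst (λ δ → sortDesc δ ≡ δ) typeT₀≡γ (sortDesc-idempotent (map (codimℕ d) T₀))
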